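{- For every positive integer $n$, the following statistics on $S_n$ are homomesic with respect to the Kreweras complement $\mathcal{K}$ and with respect to its inverse $\mathcal{K}^{ -1}$: (1) the number of exceedances; (2) the number of weak deficiencies; (3) the last entry $\sigma_n$; (4) when $n$ is even, the entry $\sigma_{n/2}$.
   Context: A statistic $f$ is homomesic with respect to a bijection $\mathcal{X}$ of a finite set if there is a constant $c$ such that its average over every orbit of $\mathcal{X}$ equals $c$. Permutations are in one-line notation and composed right to left. Let $c\in S_n$ be the long cycle $c=234\cdots n1$ (i.e. $c(i)=i+1$ for $i<n$, $c(n)=1$). The Kreweras complement is $\mathcal{K}(\sigma)=c\circ\sigma^{ -1}$, with inverse $\mathcal{K}^{ -1}(\sigma)=\sigma^{ -1}\circ c$. An index $i$ is an exceedance of $\sigma$ if $\sigma_i>i$ and a weak deficiency if $\sigma_i\le i$. -}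

module Defs where

open import Data.Nat using (ℕ; zero; suc; _<_; _≤_)
open import Data.Nat.Properties using (_<?_; _≤?_)
open import Data.Fin using (Fin; toℕ; fromℕ<) renaming (zero to fzero; suc to fsuc)
open import Data.Fin.Properties using (any?) renaming (_≟_ to _≟ᶠ_)
open import Data.Vec using (Vec; lookup; tabulate)
open import Data.Product using (∃; _,_; _×_)
open import Data.Bool using (Bool; if_then_else_)
open import Data.Rational using (ℚ; _*_; _+_; 0ℚ)
import Data.Nat
import Data.Fin
open import Data.Integer using (+_)
open import Data.Rational using (_/_)
open import Relation.Nullary using (yes; no; ¬_)
open import Relation.Nullary.Decidable using (⌊_⌋)
open import Relation.Binary.PropositionalEquality using (_≡_)

ℕ→ℚ : ℕ → ℚ
ℕ→ℚ k = (+ k) / 1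

-- Homomesy for a map X on a set A (statistic f : A → ℚ), restricted to
-- the elements satisfying P (the finite set on which X is a bijection).

iter : ∀ {a} {A : Set a} → (A → A) → ℕ → A → A
iter X zero    x = x
iter X (suc k) x = X (iter X k x)

sumTo : ℕ → (ℕ → ℚ) → ℚ
sumTo zero    g = 0ℚ
sumTo (suc k) g = sumTo k g + g k

-- ℓ is the size of the X-orbit of x: least positive ℓ with X^ℓ x = x
-- (the orbit is then {X^i x : i < ℓ}, these being pairwise distinct).
IsOrbitSize : ∀ {a} {A : Set a} → (A → A) → A → ℕ → Set a
IsOrbitSize X x ℓ = (0 < ℓ) × (iter X ℓ x ≡ x) × (∀ j → 0 < j → j < ℓ → ¬ (iter X j x ≡ x))

Homomesic : ∀ {a p} {A : Set a} (P : A → Set p) → (A → A) → (A → ℚ) → Set _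
Homomesic {A = A} P X f =
  ∃ λ (c : ℚ) → ∀ (x : A) → P x → ∀ ℓ → IsOrbitSize X x ℓ →
    sumTo ℓ (λ i → f (iter X i x)) ≡ c * ℕ→ℚ ℓ

-- Permutations of [n], encoded 0-based: σ : Vec (Fin n) n, where the
-- paper's σ_i (i ∈ {1..n}) is  1 + toℕ (lookup σ (i-1)).

IsPerm : ∀ {n} → Vec (Fin n) n → Set
IsPerm {n} σ = ∀ (i j : Fin n) → lookup σ i ≡ lookup σ j → i ≡ j

-- long cycle c = 23⋯n1 (0-based: k ↦ k+1, n-1 ↦ 0)
cyc : ∀ {n} → Fin n → Fin n
cyc {suc n} k with suc (toℕ k) <? suc n
... | yes p = fromℕ< p
... | no  _ = fzero

-- preimage of j under σ (found by search; correct when σ is a permutation)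
preimage : ∀ {n} → Vec (Fin n) n → Fin n → Fin n
preimage σ j with any? (λ i → lookup σ i ≟ᶠ j)
... | yes (i , _) = i
... | no  _       = j

inverse : ∀ {n} → Vec (Fin n) n → Vec (Fin n) n
inverse σ = tabulate (preimage σ)

_∘ₚ_ : ∀ {n} → Vec (Fin n) n → Vec (Fin n) n → Vec (Fin n) n
σ ∘ₚ τ = tabulate (λ i → lookup σ (lookup τ i))

cycVec : ∀ {n} → Vec (Fin n) n
cycVec = tabulate cyc

kreweras : ∀ {n} → Vec (Fin n) n → Vec (Fin n) n
kreweras σ = cycVec ∘ₚ inverse σ

krewerasInv : ∀ {n} → Vec (Fin n) n → Vec (Fin n) n
krewerasInv σ = inverse σ ∘ₚ cycVec

count : ∀ {n} → (Fin n → Bool) → ℕ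
count {zero}  P = 0
count {suc n} P = (if P fzero then 1 else 0) Data.Nat.+ count (λ i → P (fsuc i))

exc : ∀ {n} → Vec (Fin n) n → ℕ
exc σ = count (λ i → ⌊ toℕ i <? toℕ (lookup σ i) ⌋)

wdef : ∀ {n} → Vec (Fin n) n → ℕ
wdef σ = count (λ i → ⌊ toℕ (lookup σ i) ≤? toℕ i ⌋)

-- value (1-based) of the entry at 0-based position k
entry : ∀ {n} → Vec (Fin n) n → Fin n → ℕ
entry σ k = suc (toℕ (lookup σ k))

lastEntry : ∀ {n} → Vec (Fin (suc n)) (suc n) → ℕ
lastEntry {n} σ = entry σ (Data.Fin.fromℕ n)

-- middle entry σ_m for n = 2m (1-based position m, 0-based m-1), m ≥ 1
midEntry : ∀ m → Vec (Fin (suc m Data.Nat.+ suc m)) (suc m Data.Nat.+ suc m) → ℕ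
midEntry m σ = entry σ (Data.Fin._↑ˡ_ (Data.Fin.fromℕ m) (suc m))

module Submission where

-- Two facts about the Kreweras complement drive the proof: K(σ)(σ(i)) = c(i), and K² is
-- conjugation by the long cycle c.  The first makes exc σ + exc K(σ) constant: the conditions
-- i < σ(i) and σ(i) < c(i) = i + 1 are complementary except at the last position, where both
-- fail; weak deficiencies follow since wdef = n − exc.  For the entry at a position p with
-- 2p ≡ 0 (mod n), record each entry σ(j) by its offset σ(j) − j + p (mod n).  Conjugation by c
-- rotates positions but preserves offsets, so along 2n consecutive iterates of K the entries at p
-- run once through the offsets of σ and of K(σ) at every position; pairing j with σ(j), each pair
-- of offsets sums to a constant because 2p ≡ 0.
-- Thus every statistic has a constant sum T over all windows of some fixed length w along
-- K-orbits, and summing an orbit of size ℓ over w·ℓ steps in two ways gives average T / w.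
-- A window of K⁻¹ is a window of K read backwards.

open import Defs
open import Data.Nat using (ℕ; zero; suc; _+_; _*_; _∸_; _<_; _≤_; z≤n; s≤s; NonZero)
open import Data.Nat.Properties
open import Data.Nat.DivMod
  using (_%_; _/_; %-distribˡ-+; m%n%n≡m%n; [m+n]%n≡m%n; m<n⇒m%n≡m; m%n<n; n%n≡0; m≡m%n+[m/n]*n; m<n*o⇒m/o<n)
open import Data.Nat.Tactic.RingSolver using (solve-∀)
import Data.Integer as ℤ
import Data.Integer.Properties as ℤ
import Data.Rational as ℚ
import Data.Rational.Properties as ℚ
open import Data.Rational.Unnormalised using (mkℚᵘ; *≡*) renaming (_≃_ to _≃ᵘ_; _+_ to _+ᵘ_; _*_ to _*ᵘ_)
import Data.Rational.Unnormalised.Properties as ℚᵘ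
open import Data.Fin using (Fin; toℕ; fromℕ; inject₁; punchOut; _↑ˡ_) renaming (zero to fzero; suc to fsuc)
open import Data.Fin.Properties
  using ( any?; toℕ<n; toℕ-injective; toℕ-fromℕ; toℕ-fromℕ<; toℕ-inject₁; toℕ-↑ˡ; inject₁ℕ<
        ; injective⇒≤; punchOut-injective)
import Data.Fin.Permutation as Permutation
open import Data.Vec using (Vec; lookup)
open import Data.Vec.Properties using (lookup∘tabulate; tabulate-cong; tabulate∘lookup)
open import Algebra.Properties.CommutativeMonoid.Sum +-0-commutativeMonoid
  using (sum; sum-cong-≗; sum-permute; sum-init-last; ∑-distrib-+)
open import Data.Bool using (Bool; if_then_else_)
open import Data.Product using (∃; _,_; _×_; proj₁; proj₂)
open import Data.Sum using (inj₁; inj₂)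
open import Data.Empty using (⊥-elim)
open import Function using (_∘_; _$_)
open import Relation.Nullary using (Dec; yes; no; ¬_)
open import Relation.Nullary.Decidable using (⌊_⌋)
open import Relation.Binary.Bundles using (Setoid)
open import Relation.Binary.PropositionalEquality
import Relation.Binary.Reasoning.Setoid as SetoidReasoning

sumToℕ : ℕ → (ℕ → ℕ) → ℕ
sumToℕ zero    g = 0
sumToℕ (suc k) g = sumToℕ k g + g k

sumToℕ-cong : ∀ k {g h : ℕ → ℕ} → (∀ i → g i ≡ h i) → sumToℕ k g ≡ sumToℕ k h
sumToℕ-cong zero    g≗h = refl
sumToℕ-cong (suc k) g≗h = cong₂ _+_ (sumToℕ-cong k g≗h) (g≗h k)

sumToℕ-+ : ∀ a b g → sumToℕ (a + b) g ≡ sumToℕ a g + sumToℕ b (λ i → g (a + i))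
sumToℕ-+ a zero    g = trans (cong (λ k → sumToℕ k g) (+-identityʳ a)) (sym (+-identityʳ _))
sumToℕ-+ a (suc b) g = begin
  sumToℕ (a + suc b) g                                ≡⟨ cong (λ k → sumToℕ k g) (+-suc a b) ⟩
  sumToℕ (a + b) g + g (a + b)                        ≡⟨ cong (_+ g (a + b)) (sumToℕ-+ a b g) ⟩
  sumToℕ a g + sumToℕ b (λ i → g (a + i)) + g (a + b) ≡⟨ +-assoc (sumToℕ a g) _ _ ⟩
  sumToℕ a g + sumToℕ (suc b) (λ i → g (a + i))       ∎
  where open ≡-Reasoning

sumToℕ-const : ∀ k c → sumToℕ k (λ _ → c) ≡ k * c
sumToℕ-const zero    c = refl
sumToℕ-const (suc k) c = trans (cong (_+ c) (sumToℕ-const k c)) (+-comm (k * c) c)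

toℚᵘ-ℕ→ℚ : ∀ k → ℚ.toℚᵘ (ℕ→ℚ k) ≃ᵘ mkℚᵘ (ℤ.+ k) 0
toℚᵘ-ℕ→ℚ k = ℚ.toℚᵘ-fromℚᵘ (mkℚᵘ (ℤ.+ k) 0)

ℕ→ℚ-+ : ∀ a b → ℕ→ℚ (a + b) ≡ ℕ→ℚ a ℚ.+ ℕ→ℚ b
ℕ→ℚ-+ a b = ℚ.toℚᵘ-injective (let open ℚᵘ.≃-Reasoning in begin
  ℚ.toℚᵘ (ℕ→ℚ (a + b))                   ≈⟨ toℚᵘ-ℕ→ℚ (a + b) ⟩
  mkℚᵘ (ℤ.+ (a + b)) 0                   ≈⟨ *≡* numerators ⟩
  mkℚᵘ (ℤ.+ a) 0 +ᵘ mkℚᵘ (ℤ.+ b) 0       ≈⟨ ℚᵘ.+-cong (ℚᵘ.≃-sym (toℚᵘ-ℕ→ℚ a)) (ℚᵘ.≃-sym (toℚᵘ-ℕ→ℚ b)) ⟩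
  ℚ.toℚᵘ (ℕ→ℚ a) +ᵘ ℚ.toℚᵘ (ℕ→ℚ b)       ≈⟨ ℚᵘ.≃-sym (ℚ.toℚᵘ-homo-+ (ℕ→ℚ a) (ℕ→ℚ b)) ⟩
  ℚ.toℚᵘ (ℕ→ℚ a ℚ.+ ℕ→ℚ b)               ∎)
  where
  numerators : ℤ.+ (a + b) ℤ.* ℤ.+ 1 ≡ (ℤ.+ a ℤ.* ℤ.+ 1 ℤ.+ ℤ.+ b ℤ.* ℤ.+ 1) ℤ.* ℤ.+ 1
  numerators = cong (ℤ._* ℤ.+ 1) (trans (ℤ.pos-+ a b)
    (sym (cong₂ ℤ._+_ (ℤ.*-identityʳ (ℤ.+ a)) (ℤ.*-identityʳ (ℤ.+ b)))))

sumTo-ℕ→ℚ : ∀ k g → sumTo k (λ i → ℕ→ℚ (g i)) ≡ ℕ→ℚ (sumToℕ k g)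
sumTo-ℕ→ℚ zero    g = refl
sumTo-ℕ→ℚ (suc k) g =
  trans (cong (ℚ._+ ℕ→ℚ (g k)) (sumTo-ℕ→ℚ k g)) (sym (ℕ→ℚ-+ (sumToℕ k g) (g k)))

ℕ→ℚ-ratio : ∀ m S ℓ T → suc m * S ≡ ℓ * T → ℕ→ℚ S ≡ (ℤ.+ T ℚ./ suc m) ℚ.* ℕ→ℚ ℓ
ℕ→ℚ-ratio m S ℓ T eq = ℚ.toℚᵘ-injective (let open ℚᵘ.≃-Reasoning in begin
  ℚ.toℚᵘ (ℕ→ℚ S)                              ≈⟨ toℚᵘ-ℕ→ℚ S ⟩
  mkℚᵘ (ℤ.+ S) 0                              ≈⟨ *≡* numerators ⟩
  mkℚᵘ (ℤ.+ T) m *ᵘ mkℚᵘ (ℤ.+ ℓ) 0            ≈⟨ ℚᵘ.*-cong (ℚᵘ.≃-sym (ℚ.toℚᵘ-fromℚᵘ (mkℚᵘ (ℤ.+ T) m)))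
                                                           (ℚᵘ.≃-sym (toℚᵘ-ℕ→ℚ ℓ)) ⟩
  ℚ.toℚᵘ (ℤ.+ T ℚ./ suc m) *ᵘ ℚ.toℚᵘ (ℕ→ℚ ℓ)  ≈⟨ ℚᵘ.≃-sym (ℚ.toℚᵘ-homo-* (ℤ.+ T ℚ./ suc m) (ℕ→ℚ ℓ)) ⟩
  ℚ.toℚᵘ ((ℤ.+ T ℚ./ suc m) ℚ.* ℕ→ℚ ℓ)        ∎)
  where
  numerators : ℤ.+ S ℤ.* ℤ.+ (suc m * 1) ≡ (ℤ.+ T ℤ.* ℤ.+ ℓ) ℤ.* ℤ.+ 1
  numerators = begin
    ℤ.+ S ℤ.* ℤ.+ (suc m * 1)   ≡⟨ ℤ.pos-* S (suc m * 1) ⟨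
    ℤ.+ (S * (suc m * 1))       ≡⟨ cong ℤ.+_ S[m+1]≡Tℓ ⟩
    ℤ.+ (T * ℓ)                 ≡⟨ ℤ.pos-* T ℓ ⟩
    ℤ.+ T ℤ.* ℤ.+ ℓ             ≡⟨ ℤ.*-identityʳ _ ⟨
    (ℤ.+ T ℤ.* ℤ.+ ℓ) ℤ.* ℤ.+ 1 ∎
    where
    open ≡-Reasoning
    S[m+1]≡Tℓ : S * (suc m * 1) ≡ T * ℓ
    S[m+1]≡Tℓ = trans (cong (S *_) (*-identityʳ (suc m))) (trans (*-comm S (suc m)) (trans eq (*-comm ℓ T)))

-- Iterates, window sums and homomesy

module _ {a} {A : Set a} where

  iter-+ : ∀ (X : A → A) m k x → iter X (m + k) x ≡ iter X m (iter X k x)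
  iter-+ X zero    k x = refl
  iter-+ X (suc m) k x = cong X (iter-+ X m k x)

  iter-comm : ∀ (X : A → A) k x → iter X k (X x) ≡ X (iter X k x)
  iter-comm X zero    x = refl
  iter-comm X (suc k) x = cong X (iter-comm X k x)

  iter-periodic : ∀ (X : A → A) ℓ x → iter X ℓ x ≡ x → ∀ k → iter X (k * ℓ) x ≡ x
  iter-periodic X ℓ x Xℓx≡x zero    = refl
  iter-periodic X ℓ x Xℓx≡x (suc k) =
    trans (iter-+ X ℓ (k * ℓ) x) (trans (cong (iter X ℓ) (iter-periodic X ℓ x Xℓx≡x k)) Xℓx≡x)

  iter-rightInverse : ∀ (X Y : A → A) → (∀ x → X (Y x) ≡ x) → ∀ k x → iter X k (iter Y k x) ≡ x
  iter-rightInverse X Y XY≗id zero    x = refl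
  iter-rightInverse X Y XY≗id (suc k) x =
    trans (cong (X ∘ iter X k) (sym (iter-comm Y k x)))
      (trans (cong X (iter-rightInverse X Y XY≗id k (Y x))) (XY≗id x))

  iter-preserves : ∀ {p} {P : A → Set p} (X : A → A) → (∀ x → P x → P (X x)) →
                   ∀ k x → P x → P (iter X k x)
  iter-preserves X X-pres zero    x Px = Px
  iter-preserves X X-pres (suc k) x Px = X-pres _ (iter-preserves X X-pres k x Px)

  windowSum : (A → A) → (A → ℕ) → ℕ → A → ℕ
  windowSum X g k x = sumToℕ k (λ i → g (iter X i x))

  module _ (X : A → A) (g : A → ℕ) where

    windowSum-+ : ∀ k l x → windowSum X g (k + l) x ≡ windowSum X g k x + windowSum X g l (iter X k x)
    windowSum-+ k l x = trans (sumToℕ-+ k l _) (cong (λ s → windowSum X g k x + s) (sumToℕ-cong l shift))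
      where
      shift : ∀ i → g (iter X (k + i) x) ≡ g (iter X i (iter X k x))
      shift i = cong g (trans (cong (λ j → iter X j x) (+-comm k i)) (iter-+ X i k x))

    windowSum-blocks : ∀ k l x → windowSum X g (k * l) x ≡ sumToℕ k (λ i → windowSum X g l (iter X (i * l) x))
    windowSum-blocks zero    l x = refl
    windowSum-blocks (suc k) l x = begin
      windowSum X g (l + k * l) x                                  ≡⟨ cong (λ j → windowSum X g j x) (+-comm l (k * l)) ⟩
      windowSum X g (k * l + l) x                                  ≡⟨ windowSum-+ (k * l) l x ⟩
      windowSum X g (k * l) x + windowSum X g l (iter X (k * l) x) ≡⟨ cong (_+ windowSum X g l (iter X (k * l) x))
                                                                           (windowSum-blocks k l x) ⟩
      sumToℕ (suc k) (λ i → windowSum X g l (iter X (i * l) x))   ∎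
      where open ≡-Reasoning

    windowSum-periodic : ∀ ℓ x → iter X ℓ x ≡ x → ∀ k → windowSum X g (k * ℓ) x ≡ k * windowSum X g ℓ x
    windowSum-periodic ℓ x Xℓx≡x k = begin
      windowSum X g (k * ℓ) x                             ≡⟨ windowSum-blocks k ℓ x ⟩
      sumToℕ k (λ i → windowSum X g ℓ (iter X (i * ℓ) x)) ≡⟨ sumToℕ-cong k (λ i → cong (windowSum X g ℓ)
                                                                                     (iter-periodic X ℓ x Xℓx≡x i)) ⟩
      sumToℕ k (λ _ → windowSum X g ℓ x)                  ≡⟨ sumToℕ-const k _ ⟩
      k * windowSum X g ℓ x                               ∎
      where open ≡-Reasoning

    module _ {p} {P : A → Set p} (X-pres : ∀ x → P x → P (X x)) where

      windowSum-constant : ∀ l T → (∀ x → P x → windowSum X g l x ≡ T) →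
                           ∀ k x → P x → windowSum X g (k * l) x ≡ k * T
      windowSum-constant l T windows k x Px = begin
        windowSum X g (k * l) x                             ≡⟨ windowSum-blocks k l x ⟩
        sumToℕ k (λ i → windowSum X g l (iter X (i * l) x)) ≡⟨ sumToℕ-cong k (λ i → windows _
                                                                 (iter-preserves X X-pres (i * l) x Px)) ⟩
        sumToℕ k (λ _ → T)                                  ≡⟨ sumToℕ-const k T ⟩
        k * T                                               ∎
        where open ≡-Reasoning

      homomesic-of-constant-windows : ∀ m T → (∀ x → P x → windowSum X g (suc m) x ≡ T) →
                                      Homomesic P X (λ x → ℕ→ℚ (g x))
      homomesic-of-constant-windows m T windows = (ℤ.+ T ℚ./ suc m) , λ x Px ℓ (_ , Xℓx≡x , _) →
        trans (sumTo-ℕ→ℚ ℓ (λ i → g (iter X i x))) (ℕ→ℚ-ratio m _ ℓ T (begin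
          suc m * windowSum X g ℓ x   ≡⟨ windowSum-periodic ℓ x Xℓx≡x (suc m) ⟨
          windowSum X g (suc m * ℓ) x ≡⟨ cong (λ k → windowSum X g k x) (*-comm (suc m) ℓ) ⟩
          windowSum X g (ℓ * suc m) x ≡⟨ windowSum-constant (suc m) T windows ℓ x Px ⟩
          ℓ * T                       ∎))
        where open ≡-Reasoning

  module _ (X Y : A → A) (g : A → ℕ) {p} {P : A → Set p}
           (Y-pres : ∀ x → P x → P (Y x)) (XY≗id : ∀ x → P x → X (Y x) ≡ x) where

    windowSum-reverse : ∀ m x → P x → windowSum Y g (suc m) x ≡ windowSum X g (suc m) (iter Y m x)
    windowSum-reverse zero    x Px = refl
    windowSum-reverse (suc m) x Px = begin
      windowSum Y g (suc m) x + g y            ≡⟨ cong (_+ g y) (windowSum-reverse m x Px) ⟩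
      windowSum X g (suc m) (iter Y m x) + g y ≡⟨ cong (λ z → windowSum X g (suc m) z + g y) Xy≡Yᵐx ⟨
      windowSum X g (suc m) (X y) + g y        ≡⟨ +-comm _ (g y) ⟩
      g y + windowSum X g (suc m) (X y)        ≡⟨ windowSum-+ X g 1 (suc m) y ⟨
      windowSum X g (suc (suc m)) y            ∎
      where
      open ≡-Reasoning
      y : A
      y = iter Y (suc m) x
      Xy≡Yᵐx : X y ≡ iter Y m x
      Xy≡Yᵐx = XY≗id _ (iter-preserves Y Y-pres m x Px)

    homomesic-inverse-of-constant-windows : ∀ m T → (∀ x → P x → windowSum X g (suc m) x ≡ T) →
                                            Homomesic P Y (λ x → ℕ→ℚ (g x))
    homomesic-inverse-of-constant-windows m T windows = homomesic-of-constant-windows Y g Y-pres m T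
      (λ x Px → trans (windowSum-reverse m x Px) (windows _ (iter-preserves Y Y-pres m x Px)))

module Modular (d : ℕ) .{{_ : NonZero d}} where

  infix 4 _≋_
  record _≋_ (a b : ℕ) : Set where
    constructor from-%
    field to-% : a % d ≡ b % d
  open _≋_ public

  ≋-setoid : Setoid _ _
  ≋-setoid = record
    { Carrier       = ℕ
    ; _≈_           = _≋_
    ; isEquivalence = record
      { refl  = from-% refl
      ; sym   = λ a≋b → from-% (sym (to-% a≋b))
      ; trans = λ a≋b b≋c → from-% (trans (to-% a≋b) (to-% b≋c))
      }
    }

  module ≋-Reasoning = SetoidReasoning ≋-setoid

  %-≋ : ∀ a → a % d ≋ a
  %-≋ a = from-% (m%n%n≡m%n a d)

  +d-≋ : ∀ a → a + d ≋ a
  +d-≋ a = from-% ([m+n]%n≡m%n a d)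

  +-cong-≋ : ∀ {a b c e} → a ≋ b → c ≋ e → a + c ≋ b + e
  +-cong-≋ {a} {b} {c} {e} (from-% a≋b) (from-% c≋e) = from-% $ begin
    (a + c) % d         ≡⟨ %-distribˡ-+ a c d ⟩
    (a % d + c % d) % d ≡⟨ cong₂ (λ x y → (x + y) % d) a≋b c≋e ⟩
    (b % d + e % d) % d ≡⟨ %-distribˡ-+ b e d ⟨
    (b + e) % d         ∎
    where open ≡-Reasoning

  +-congˡ-≋ : ∀ c {a b} → a ≋ b → c + a ≋ c + b
  +-congˡ-≋ c = +-cong-≋ (from-% refl)

  +-congʳ-≋ : ∀ c {a b} → a ≋ b → a + c ≋ b + c
  +-congʳ-≋ c a≋b = +-cong-≋ a≋b (from-% refl)

  ≋⇒≡ : ∀ {a b} → a < d → b < d → a ≋ b → a ≡ b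
  ≋⇒≡ {a} {b} a<d b<d (from-% a≋b) = trans (sym (m<n⇒m%n≡m a<d)) (trans a≋b (m<n⇒m%n≡m b<d))

  [d∸c%d]+[c+a]≋a : ∀ c a → d ∸ c % d + (c + a) ≋ a
  [d∸c%d]+[c+a]≋a c a = begin
    d ∸ r + (c + a) ≈⟨ +-congˡ-≋ (d ∸ r) (+-congʳ-≋ a (%-≋ c)) ⟨
    d ∸ r + (r + a) ≡⟨ +-assoc (d ∸ r) r a ⟨
    d ∸ r + r + a   ≡⟨ cong (_+ a) (m∸n+n≡m (<⇒≤ (m%n<n c d))) ⟩
    d + a           ≡⟨ +-comm d a ⟩
    a + d           ≈⟨ +d-≋ a ⟩
    a               ∎
    where
    open ≋-Reasoning
    r : ℕ
    r = c % d

  +-cancelˡ-≋ : ∀ c {a b} → c + a ≋ c + b → a ≋ b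
  +-cancelˡ-≋ c {a} {b} ca≋cb = begin
    a                   ≈⟨ [d∸c%d]+[c+a]≋a c a ⟨
    d ∸ c % d + (c + a) ≈⟨ +-congˡ-≋ (d ∸ c % d) ca≋cb ⟩
    d ∸ c % d + (c + b) ≈⟨ [d∸c%d]+[c+a]≋a c b ⟩
    b                   ∎
    where open ≋-Reasoning

  ∸-cong-≋ : ∀ {a b} → a ≤ d → b ≤ d → a ≋ b → d ∸ a ≋ d ∸ b
  ∸-cong-≋ {a} {b} a≤d b≤d a≋b = +-cancelˡ-≋ a (begin
    a + (d ∸ a) ≡⟨ m+[n∸m]≡n a≤d ⟩
    d           ≡⟨ m+[n∸m]≡n b≤d ⟨
    b + (d ∸ b) ≈⟨ +-congʳ-≋ (d ∸ b) a≋b ⟨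
    a + (d ∸ b) ∎)
    where open ≋-Reasoning

  m%d≡0⇒m≡d : ∀ {m} → m % d ≡ 0 → 0 < m → m < 2 * d → m ≡ d
  m%d≡0⇒m≡d {m} m%d≡0 0<m m<2d
    with m / d | m<n*o⇒m/o<n {m} {2} {d} m<2d | trans (m≡m%n+[m/n]*n m d) (cong (_+ (m / d) * d) m%d≡0)
  ... | zero        | _            | m≡0 = ⊥-elim (<-irrefl (sym m≡0) 0<m)
  ... | suc zero    | _            | m≡d = trans m≡d (+-identityʳ d)
  ... | suc (suc _) | s≤s (s≤s ()) | _

injective⇒surjective : ∀ {n} (f : Fin n → Fin n) → (∀ i j → f i ≡ f j → i ≡ j) → ∀ j → ∃ λ i → f i ≡ j
injective⇒surjective {zero}  f f-inj ()
injective⇒surjective {suc n} f f-inj j with any? (λ i → f i Data.Fin.≟ j)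
... | yes hit = hit
... | no miss = ⊥-elim (<-irrefl refl (injective⇒≤ avoid-j-injective))
  where
  f≢j : ∀ i → j ≢ f i
  f≢j i j≡fi = miss (i , sym j≡fi)
  avoid-j-injective : ∀ {a b} → punchOut (f≢j a) ≡ punchOut (f≢j b) → a ≡ b
  avoid-j-injective {a} {b} eq = f-inj a b (punchOut-injective (f≢j a) (f≢j b) eq)

sum-reindex : ∀ {n} (f : Fin n → Fin n) → (∀ i j → f i ≡ f j → i ≡ j) → (g : Fin n → ℕ) →
              sum (λ i → g (f i)) ≡ sum g
sum-reindex {n} f f-inj g = sym (sum-permute g π)
  where
  f⁻¹ : Fin n → Fin n
  f⁻¹ j = proj₁ (injective⇒surjective f f-inj j)
  π : Permutation.Permutation n n
  π = Permutation.permutation f f⁻¹ (λ j → proj₂ (injective⇒surjective f f-inj j))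
                                    (λ i → f-inj _ _ (proj₂ (injective⇒surjective f f-inj (f i))))

sum-const : ∀ {n} c → sum {n} (λ _ → c) ≡ n * c
sum-const {zero}  c = refl
sum-const {suc n} c = cong (c +_) (sum-const {n} c)

sumToℕ≡sum : ∀ n h → sumToℕ n h ≡ sum {n} (λ i → h (toℕ i))
sumToℕ≡sum zero    h = refl
sumToℕ≡sum (suc n) h = begin
  sumToℕ n h + h n                                        ≡⟨ cong (_+ h n) (sumToℕ≡sum n h) ⟩
  sum {n} (λ i → h (toℕ i)) + h n                         ≡⟨ cong₂ _+_ (sum-cong-≗ {n} (λ i → cong h (sym (toℕ-inject₁ i))))
                                                                        (cong h (sym (toℕ-fromℕ n))) ⟩
  sum {n} (λ i → h (toℕ (inject₁ i))) + h (toℕ (fromℕ n)) ≡⟨ sum-init-last (λ i → h (toℕ i)) ⟨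
  sum {suc n} (λ i → h (toℕ i))                           ∎
  where open ≡-Reasoning

indicator : Bool → ℕ
indicator b = if b then 1 else 0

count≡sum : ∀ {n} (P : Fin n → Bool) → count P ≡ sum (λ i → indicator (P i))
count≡sum {zero}  P = refl
count≡sum {suc n} P = cong (indicator (P fzero) +_) (count≡sum (λ i → P (fsuc i)))

indicator-exclusive : ∀ {A B : Set} (A? : Dec A) (B? : Dec B) → (A → ¬ B) → (¬ A → B) →
                      indicator ⌊ A? ⌋ + indicator ⌊ B? ⌋ ≡ 1
indicator-exclusive A? B? A⇒¬B ¬A⇒B with A? | B?
... | yes a | yes b = ⊥-elim (A⇒¬B a b)
... | yes _ | no  _ = refl
... | no  _ | yes _ = refl
... | no ¬a | no ¬b = ⊥-elim (¬b (¬A⇒B ¬a))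

indicator-¬ : ∀ {A : Set} (A? : Dec A) → ¬ A → indicator ⌊ A? ⌋ ≡ 0
indicator-¬ (yes a) ¬a = ⊥-elim (¬a a)
indicator-¬ (no _)  _  = refl

-- Permutations, the long cycle and the Kreweras complement

module _ {n} (σ : Vec (Fin n) n) (σ-perm : IsPerm σ) where

  lookup-preimage : ∀ j → lookup σ (preimage σ j) ≡ j
  lookup-preimage j with any? (λ i → lookup σ i Data.Fin.≟ j)
  ... | yes (i , σi≡j) = σi≡j
  ... | no  miss       = ⊥-elim (miss (injective⇒surjective (lookup σ) σ-perm j))

  preimage-lookup : ∀ i → preimage σ (lookup σ i) ≡ i
  preimage-lookup i = σ-perm _ _ (lookup-preimage (lookup σ i))

  preimage-injective : ∀ i j → preimage σ i ≡ preimage σ j → i ≡ j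
  preimage-injective i j eq = trans (sym (lookup-preimage i)) (trans (cong (lookup σ) eq) (lookup-preimage j))

toℕ-cyc : ∀ {n} (x : Fin (suc n)) → toℕ (cyc x) ≡ suc (toℕ x) % suc n
toℕ-cyc {n} x with suc (toℕ x) <? suc n
... | yes x+1<N = trans (toℕ-fromℕ< x+1<N) (sym (m<n⇒m%n≡m x+1<N))
... | no  x+1≮N = sym (trans (cong (_% suc n) x+1≡N) (n%n≡0 (suc n)))
  where
  x+1≡N : suc (toℕ x) ≡ suc n
  x+1≡N = ≤-antisym (toℕ<n x) (≮⇒≥ x+1≮N)

toℕ-cyc-inject₁ : ∀ {n} (k : Fin n) → toℕ (cyc (inject₁ k)) ≡ suc (toℕ (inject₁ k))
toℕ-cyc-inject₁ k = trans (toℕ-cyc (inject₁ k)) (m<n⇒m%n≡m (s≤s (inject₁ℕ< k)))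

toℕ-cyc-fromℕ : ∀ n → toℕ (cyc (fromℕ n)) ≡ 0
toℕ-cyc-fromℕ n = trans (toℕ-cyc (fromℕ n)) (trans (cong (λ k → suc k % suc n) (toℕ-fromℕ n)) (n%n≡0 (suc n)))

module _ {n : ℕ} where
  open Modular (suc n)

  toℕ-cyc-≋ : ∀ (x : Fin (suc n)) → toℕ (cyc x) ≋ suc (toℕ x)
  toℕ-cyc-≋ x = from-% (trans (cong (_% suc n) (toℕ-cyc x)) (to-% (%-≋ (suc (toℕ x)))))

  cyc-injective : ∀ (x y : Fin (suc n)) → cyc x ≡ cyc y → x ≡ y
  cyc-injective x y cx≡cy = toℕ-injective (≋⇒≡ (toℕ<n x) (toℕ<n y) (+-cancelˡ-≋ 1 (begin
    suc (toℕ x) ≈⟨ toℕ-cyc-≋ x ⟨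
    toℕ (cyc x) ≡⟨ cong toℕ cx≡cy ⟩
    toℕ (cyc y) ≈⟨ toℕ-cyc-≋ y ⟩
    suc (toℕ y) ∎)))
    where open ≋-Reasoning

  toℕ-iter-cyc : ∀ k (x : Fin (suc n)) → toℕ (iter cyc k x) ≋ toℕ x + k
  toℕ-iter-cyc zero    x = from-% (cong (_% suc n) (sym (+-identityʳ (toℕ x))))
  toℕ-iter-cyc (suc k) x = begin
    toℕ (cyc (iter cyc k x)) ≈⟨ toℕ-cyc-≋ (iter cyc k x) ⟩
    suc (toℕ (iter cyc k x)) ≈⟨ +-congˡ-≋ 1 (toℕ-iter-cyc k x) ⟩
    suc (toℕ x + k)          ≡⟨ +-suc (toℕ x) k ⟨
    toℕ x + suc k            ∎
    where open ≋-Reasoning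

  iter-cyc-fixed : ∀ k (y : Fin (suc n)) → k < suc n → iter cyc k y ≡ y → k ≡ 0
  iter-cyc-fixed k y k<N cᵏy≡y = ≋⇒≡ k<N (s≤s z≤n) (+-cancelˡ-≋ (toℕ y) (begin
    toℕ y + k          ≈⟨ toℕ-iter-cyc k y ⟨
    toℕ (iter cyc k y) ≡⟨ cong toℕ cᵏy≡y ⟩
    toℕ y              ≡⟨ +-identityʳ (toℕ y) ⟨
    toℕ y + 0          ∎))
    where open ≋-Reasoning

  cycVec-isPerm : IsPerm (cycVec {suc n})
  cycVec-isPerm i j eq = cyc-injective i j (trans (sym (lookup∘tabulate cyc i)) (trans eq (lookup∘tabulate cyc j)))

  cycInv : Fin (suc n) → Fin (suc n)
  cycInv = preimage cycVec

  cyc-cycInv : ∀ j → cyc (cycInv j) ≡ j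
  cyc-cycInv j = trans (sym (lookup∘tabulate cyc (cycInv j))) (lookup-preimage cycVec cycVec-isPerm j)

  iter-cycInv-injective-≤ : ∀ y {a b} → a ≤ b → b < suc n → iter cycInv a y ≡ iter cycInv b y → a ≡ b
  iter-cycInv-injective-≤ y {a} {b} a≤b b<N eq =
    ≤-antisym a≤b (m∸n≡0⇒m≤n (iter-cyc-fixed (b ∸ a) y (≤-<-trans (m∸n≤m b a) b<N) (begin
      iter cyc (b ∸ a) y                              ≡⟨ cong (iter cyc (b ∸ a)) (iter-rightInverse cyc cycInv cyc-cycInv a y) ⟨
      iter cyc (b ∸ a) (iter cyc a (iter cycInv a y)) ≡⟨ iter-+ cyc (b ∸ a) a _ ⟨
      iter cyc (b ∸ a + a) (iter cycInv a y)          ≡⟨ cong (λ k → iter cyc k (iter cycInv a y)) (m∸n+n≡m a≤b) ⟩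
      iter cyc b (iter cycInv a y)                    ≡⟨ cong (iter cyc b) eq ⟩
      iter cyc b (iter cycInv b y)                    ≡⟨ iter-rightInverse cyc cycInv cyc-cycInv b y ⟩
      y                                               ∎)))
    where open ≡-Reasoning

  iter-cycInv-injective : ∀ y (i j : Fin (suc n)) → iter cycInv (toℕ i) y ≡ iter cycInv (toℕ j) y → i ≡ j
  iter-cycInv-injective y i j eq with ≤-total (toℕ i) (toℕ j)
  ... | inj₁ i≤j = toℕ-injective (iter-cycInv-injective-≤ y i≤j (toℕ<n j) eq)
  ... | inj₂ j≤i = toℕ-injective (sym (iter-cycInv-injective-≤ y j≤i (toℕ<n i) (sym eq)))

  lookup-kreweras : ∀ (σ : Vec (Fin (suc n)) (suc n)) j → lookup (kreweras σ) j ≡ cyc (preimage σ j)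
  lookup-kreweras σ j = trans (lookup∘tabulate (λ i → lookup cycVec (lookup (inverse σ) i)) j)
    (trans (lookup∘tabulate cyc _) (cong cyc (lookup∘tabulate (preimage σ) j)))

  lookup-krewerasInv : ∀ (σ : Vec (Fin (suc n)) (suc n)) j → lookup (krewerasInv σ) j ≡ preimage σ (cyc j)
  lookup-krewerasInv σ j = trans (lookup∘tabulate (λ i → lookup (inverse σ) (lookup cycVec i)) j)
    (trans (lookup∘tabulate (preimage σ) _) (cong (preimage σ) (lookup∘tabulate cyc j)))

  module _ (σ : Vec (Fin (suc n)) (suc n)) (σ-perm : IsPerm σ) where

    kreweras-isPerm : IsPerm (kreweras σ)
    kreweras-isPerm i j eq = preimage-injective σ σ-perm i j
      (cyc-injective _ _ (trans (sym (lookup-kreweras σ i)) (trans eq (lookup-kreweras σ j))))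

    krewerasInv-isPerm : IsPerm (krewerasInv σ)
    krewerasInv-isPerm i j eq = cyc-injective i j
      (preimage-injective σ σ-perm _ _ (trans (sym (lookup-krewerasInv σ i)) (trans eq (lookup-krewerasInv σ j))))

    kreweras-lookup : ∀ i → lookup (kreweras σ) (lookup σ i) ≡ cyc i
    kreweras-lookup i = trans (lookup-kreweras σ (lookup σ i)) (cong cyc (preimage-lookup σ σ-perm i))

    kreweras²-cyc : ∀ j → lookup (kreweras (kreweras σ)) (cyc j) ≡ cyc (lookup σ j)
    kreweras²-cyc j = begin
      lookup (kreweras (kreweras σ)) (cyc j)                         ≡⟨ lookup-kreweras (kreweras σ) (cyc j) ⟩
      cyc (preimage (kreweras σ) (cyc j))                            ≡⟨ cong (cyc ∘ preimage (kreweras σ)) (kreweras-lookup j) ⟨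
      cyc (preimage (kreweras σ) (lookup (kreweras σ) (lookup σ j))) ≡⟨ cong cyc (preimage-lookup (kreweras σ) kreweras-isPerm
                                                                                                     (lookup σ j)) ⟩
      cyc (lookup σ j)                                               ∎
      where open ≡-Reasoning

    kreweras-krewerasInv : kreweras (krewerasInv σ) ≡ σ
    kreweras-krewerasInv = trans (sym (tabulate∘lookup _)) (trans (tabulate-cong pointwise) (tabulate∘lookup σ))
      where
      pointwise : ∀ j → lookup (kreweras (krewerasInv σ)) j ≡ lookup σ j
      pointwise j = begin
        lookup (kreweras (krewerasInv σ)) j ≡⟨ lookup-kreweras (krewerasInv σ) j ⟩
        cyc i                               ≡⟨ lookup-preimage σ σ-perm (cyc i) ⟨
        lookup σ (preimage σ (cyc i))       ≡⟨ cong (lookup σ) σ⁻¹ci≡j ⟩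
        lookup σ j                          ∎
        where
        open ≡-Reasoning
        i : Fin (suc n)
        i = preimage (krewerasInv σ) j
        σ⁻¹ci≡j : preimage σ (cyc i) ≡ j
        σ⁻¹ci≡j = trans (sym (lookup-krewerasInv σ i)) (lookup-preimage (krewerasInv σ) krewerasInv-isPerm j)

  kreweras-homomesic : ∀ (g : Vec (Fin (suc n)) (suc n) → ℕ) m T →
                       (∀ σ → IsPerm σ → windowSum kreweras g (suc m) σ ≡ T) →
                       Homomesic IsPerm kreweras (λ σ → ℕ→ℚ (g σ)) × Homomesic IsPerm krewerasInv (λ σ → ℕ→ℚ (g σ))
  kreweras-homomesic g m T windows =
      homomesic-of-constant-windows kreweras g kreweras-isPerm m T windows
    , homomesic-inverse-of-constant-windows kreweras krewerasInv g krewerasInv-isPerm kreweras-krewerasInv m T windows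

-- Exceedances and weak deficiencies

wdef+exc : ∀ {n} (σ : Vec (Fin n) n) → wdef σ + exc σ ≡ n
wdef+exc {n} σ = begin
  wdef σ + exc σ                                            ≡⟨ cong₂ _+_ (count≡sum W) (count≡sum E) ⟩
  sum (λ i → indicator (W i)) + sum (λ i → indicator (E i)) ≡⟨ ∑-distrib-+ (λ i → indicator (W i)) (λ i → indicator (E i)) ⟨
  sum (λ i → indicator (W i) + indicator (E i))             ≡⟨ sum-cong-≗ exactly-one ⟩
  sum {n} (λ _ → 1)                                         ≡⟨ sum-const {n} 1 ⟩
  n * 1                                                     ≡⟨ *-identityʳ n ⟩
  n                                                         ∎
  where
  open ≡-Reasoning
  W E : Fin n → Bool
  W i = ⌊ toℕ (lookup σ i) ≤? toℕ i ⌋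
  E i = ⌊ toℕ i <? toℕ (lookup σ i) ⌋
  exactly-one : ∀ i → indicator (W i) + indicator (E i) ≡ 1
  exactly-one i = indicator-exclusive (toℕ (lookup σ i) ≤? toℕ i) (toℕ i <? toℕ (lookup σ i)) ≤⇒≯ ≰⇒>

exc+exc-kreweras : ∀ {n} (σ : Vec (Fin (suc n)) (suc n)) → IsPerm σ → exc σ + exc (kreweras σ) ≡ n
exc+exc-kreweras {n} σ σ-perm = begin
  exc σ + exc (kreweras σ)                    ≡⟨ cong₂ _+_ (count≡sum (λ i → ⌊ toℕ i <? val i ⌋))
                                                           (count≡sum (λ j → ⌊ toℕ j <? toℕ (lookup (kreweras σ) j) ⌋)) ⟩
  sum E + sum E′                              ≡⟨ cong (sum E +_) (sum-reindex (lookup σ) σ-perm E′) ⟨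
  sum E + sum (λ i → E′ (lookup σ i))         ≡⟨ cong (sum E +_) (sum-cong-≗ E′∘σ≗F) ⟩
  sum E + sum F                               ≡⟨ ∑-distrib-+ E F ⟨
  sum (λ i → E i + F i)                       ≡⟨ sum-init-last (λ i → E i + F i) ⟩
  sum {n} (λ k → E (inject₁ k) + F (inject₁ k)) + (E (fromℕ n) + F (fromℕ n))
                                              ≡⟨ cong₂ _+_ (sum-cong-≗ {n} exactly-one) neither ⟩
  sum {n} (λ _ → 1) + 0                       ≡⟨ +-identityʳ _ ⟩
  sum {n} (λ _ → 1)                           ≡⟨ sum-const {n} 1 ⟩
  n * 1                                       ≡⟨ *-identityʳ n ⟩
  n                                           ∎
  where
  open ≡-Reasoning
  val : Fin (suc n) → ℕ
  val i = toℕ (lookup σ i)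
  E E′ F : Fin (suc n) → ℕ
  E i = indicator ⌊ toℕ i <? val i ⌋
  E′ j = indicator ⌊ toℕ j <? toℕ (lookup (kreweras σ) j) ⌋
  F i = indicator ⌊ val i <? toℕ (cyc i) ⌋
  E′∘σ≗F : ∀ i → E′ (lookup σ i) ≡ F i
  E′∘σ≗F i = cong (λ j → indicator ⌊ val i <? toℕ j ⌋) (kreweras-lookup σ σ-perm i)
  exactly-one : ∀ k → E (inject₁ k) + F (inject₁ k) ≡ 1
  exactly-one k = trans (cong (λ c → E i + indicator ⌊ val i <? c ⌋) (toℕ-cyc-inject₁ k))
    (indicator-exclusive (toℕ i <? val i) (val i <? suc (toℕ i))
      (λ i<σi σi<1+i → <⇒≱ i<σi (≤-pred σi<1+i)) (λ i≮σi → s≤s (≮⇒≥ i≮σi)))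
    where
    i : Fin (suc n)
    i = inject₁ k
  neither : E (fromℕ n) + F (fromℕ n) ≡ 0
  neither = cong₂ _+_
    (indicator-¬ (toℕ (fromℕ n) <? val (fromℕ n))
      (λ n<σn → <⇒≱ (subst (_< val (fromℕ n)) (toℕ-fromℕ n) n<σn) (≤-pred (toℕ<n (lookup σ (fromℕ n))))))
    (indicator-¬ (val (fromℕ n) <? toℕ (cyc (fromℕ n)))
      (λ σn<c → n≮0 (subst (val (fromℕ n) <_) (toℕ-cyc-fromℕ n) σn<c)))

wdef+wdef-kreweras : ∀ {n} (σ : Vec (Fin (suc n)) (suc n)) → IsPerm σ → wdef σ + wdef (kreweras σ) ≡ suc (suc n)
wdef+wdef-kreweras {n} σ σ-perm = +-cancelˡ-≡ (exc σ + exc (kreweras σ)) _ _ (begin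
  (exc σ + exc (kreweras σ)) + (wdef σ + wdef (kreweras σ)) ≡⟨ interchange (exc σ) _ (wdef σ) _ ⟩
  (wdef σ + exc σ) + (wdef (kreweras σ) + exc (kreweras σ)) ≡⟨ cong₂ _+_ (wdef+exc σ) (wdef+exc (kreweras σ)) ⟩
  suc n + suc n                                             ≡⟨ +-suc n (suc n) ⟨
  n + suc (suc n)                                           ≡⟨ cong (_+ suc (suc n)) (exc+exc-kreweras σ σ-perm) ⟨
  (exc σ + exc (kreweras σ)) + suc (suc n)                  ∎)
  where
  open ≡-Reasoning
  interchange : ∀ a b c d → (a + b) + (c + d) ≡ (c + a) + (d + b)
  interchange = solve-∀

-- Entries at positions p with 2(p + 1) ≡ 0

module _ {n : ℕ} (p : Fin (suc n)) where
  open Modular (suc n)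

  -- The offset τ(j) − j + p of the entry at j, modulo n + 1 (0-based values and positions):
  -- the entry at p of the conjugate of τ by the power of c that moves j to p.
  rotatedEntry : Vec (Fin (suc n)) (suc n) → Fin (suc n) → ℕ
  rotatedEntry τ j = (toℕ (lookup τ j) + toℕ p + (suc n ∸ toℕ j)) % suc n

  rotatedEntry-self : ∀ τ → rotatedEntry τ p ≡ toℕ (lookup τ p)
  rotatedEntry-self τ = begin
    (y + toℕ p + (suc n ∸ toℕ p)) % suc n   ≡⟨ cong (_% suc n) (+-assoc y (toℕ p) _) ⟩
    (y + (toℕ p + (suc n ∸ toℕ p))) % suc n ≡⟨ cong (λ k → (y + k) % suc n) (m+[n∸m]≡n (<⇒≤ (toℕ<n p))) ⟩
    (y + suc n) % suc n                     ≡⟨ to-% (+d-≋ y) ⟩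
    y % suc n                               ≡⟨ m<n⇒m%n≡m (toℕ<n (lookup τ p)) ⟩
    y                                       ∎
    where
    open ≡-Reasoning
    y : ℕ
    y = toℕ (lookup τ p)

  rotatedEntry-kreweras² : ∀ τ → IsPerm τ → ∀ j → rotatedEntry (kreweras (kreweras τ)) (cyc j) ≡ rotatedEntry τ j
  rotatedEntry-kreweras² τ τ-perm j = to-% $ begin
    toℕ (lookup (kreweras (kreweras τ)) (cyc j)) + P + (suc n ∸ toℕ (cyc j))
      ≡⟨ cong (λ v → toℕ v + P + (suc n ∸ toℕ (cyc j))) (kreweras²-cyc τ τ-perm j) ⟩
    toℕ (cyc (lookup τ j)) + P + (suc n ∸ toℕ (cyc j))
      ≈⟨ +-cong-≋ (+-congʳ-≋ P (toℕ-cyc-≋ (lookup τ j)))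
                  (∸-cong-≋ (<⇒≤ (toℕ<n (cyc j))) (toℕ<n j) (toℕ-cyc-≋ j)) ⟩
    suc y + P + (suc n ∸ suc (toℕ j))
      ≡⟨ +-suc (y + P) _ ⟨
    y + P + suc (suc n ∸ suc (toℕ j))
      ≡⟨ cong (y + P +_) (+-∸-assoc 1 (toℕ<n j)) ⟨
    y + P + (suc n ∸ toℕ j)
      ∎
    where
    open ≋-Reasoning
    P y : ℕ
    P = toℕ p
    y = toℕ (lookup τ j)

  rotatedEntry-iterate : ∀ τ → IsPerm τ → ∀ i j →
                         rotatedEntry (iter kreweras (i * 2) τ) j ≡ rotatedEntry τ (iter cycInv i j)
  rotatedEntry-iterate τ τ-perm zero    j = refl
  rotatedEntry-iterate τ τ-perm (suc i) j = begin
    rotatedEntry (kreweras (kreweras τᵢ)) j                ≡⟨ cong (rotatedEntry (kreweras (kreweras τᵢ))) (cyc-cycInv j) ⟨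
    rotatedEntry (kreweras (kreweras τᵢ)) (cyc (cycInv j)) ≡⟨ rotatedEntry-kreweras² τᵢ τᵢ-perm (cycInv j) ⟩
    rotatedEntry τᵢ (cycInv j)                             ≡⟨ rotatedEntry-iterate τ τ-perm i (cycInv j) ⟩
    rotatedEntry τ (iter cycInv i (cycInv j))              ≡⟨ cong (rotatedEntry τ) (iter-comm cycInv i j) ⟩
    rotatedEntry τ (iter cycInv (suc i) j)                 ∎
    where
    open ≡-Reasoning
    τᵢ : Vec (Fin (suc n)) (suc n)
    τᵢ = iter kreweras (i * 2) τ
    τᵢ-perm : IsPerm τᵢ
    τᵢ-perm = iter-preserves kreweras kreweras-isPerm (i * 2) τ τ-perm

  module _ (2p+2≡0 : (suc (toℕ p) + suc (toℕ p)) % suc n ≡ 0) where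

    -- Both offsets lie in [0, n], and since K(σ)(σ(i)) = c(i) their sum is 2p + 1 ≡ −1.
    rotatedEntry-kreweras : ∀ σ → IsPerm σ → ∀ i → rotatedEntry σ i + rotatedEntry (kreweras σ) (lookup σ i) ≡ n
    rotatedEntry-kreweras σ σ-perm i =
      suc-injective (m%d≡0⇒m≡d (trans (to-% suc-sum≋2p+2) 2p+2≡0) (s≤s z≤n) suc-sum<2[n+1])
      where
      P x y a b : ℕ
      P = toℕ p
      x = toℕ i
      y = toℕ (lookup σ i)
      a = y + P + (suc n ∸ x)
      b = toℕ (lookup (kreweras σ) (lookup σ i)) + P + (suc n ∸ y)
      regroup : ∀ x y P u v → 1 + ((y + P + u) + (suc x + P + v)) ≡ (suc P + suc P) + ((x + u) + (y + v))
      regroup = solve-∀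
      suc-sum≋2p+2 : suc (a % suc n + b % suc n) ≋ suc P + suc P
      suc-sum≋2p+2 = begin
        1 + (a % suc n + b % suc n)
          ≈⟨ +-congˡ-≋ 1 (+-cong-≋ (%-≋ a) (%-≋ b)) ⟩
        1 + (a + b)
          ≡⟨ cong (λ c → 1 + (a + (toℕ c + P + (suc n ∸ y)))) (kreweras-lookup σ σ-perm i) ⟩
        1 + (a + (toℕ (cyc i) + P + (suc n ∸ y)))
          ≈⟨ +-congˡ-≋ 1 (+-congˡ-≋ a (+-congʳ-≋ (suc n ∸ y) (+-congʳ-≋ P (toℕ-cyc-≋ i)))) ⟩
        1 + (a + (suc x + P + (suc n ∸ y)))
          ≡⟨ regroup x y P (suc n ∸ x) (suc n ∸ y) ⟩
        (suc P + suc P) + ((x + (suc n ∸ x)) + (y + (suc n ∸ y)))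
          ≡⟨ cong₂ (λ u v → (suc P + suc P) + (u + v))
                   (m+[n∸m]≡n (<⇒≤ (toℕ<n i))) (m+[n∸m]≡n (<⇒≤ (toℕ<n (lookup σ i)))) ⟩
        (suc P + suc P) + (suc n + suc n)
          ≡⟨ +-assoc (suc P + suc P) (suc n) (suc n) ⟨
        (suc P + suc P) + suc n + suc n
          ≈⟨ +d-≋ _ ⟩
        (suc P + suc P) + suc n
          ≈⟨ +d-≋ _ ⟩
        suc P + suc P
          ∎
        where open ≋-Reasoning
      suc-sum<2[n+1] : suc (a % suc n + b % suc n) < 2 * suc n
      suc-sum<2[n+1] = subst (suc (suc (a % suc n + b % suc n)) ≤_) (2+m+m≡2[1+m] n)
        (s≤s (s≤s (+-mono-≤ (≤-pred (m%n<n a (suc n))) (≤-pred (m%n<n b (suc n))))))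
        where
        2+m+m≡2[1+m] : ∀ m → 2 + (m + m) ≡ 2 * suc m
        2+m+m≡2[1+m] = solve-∀

    entry-iterate : ∀ τ → IsPerm τ → ∀ i → entry (iter kreweras (i * 2) τ) p ≡ suc (rotatedEntry τ (iter cycInv i p))
    entry-iterate τ τ-perm i =
      cong suc (trans (sym (rotatedEntry-self (iter kreweras (i * 2) τ))) (rotatedEntry-iterate τ τ-perm i p))

    entry-windowSum : ∀ σ → IsPerm σ → windowSum kreweras (λ τ → entry τ p) (suc n * 2) σ ≡ suc n * suc (suc n)
    entry-windowSum σ σ-perm = begin
      windowSum kreweras g (suc n * 2) σ                      ≡⟨ windowSum-blocks kreweras g (suc n) 2 σ ⟩
      sumToℕ (suc n) (λ i → windowSum kreweras g 2 (iter kreweras (i * 2) σ))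
                                                              ≡⟨ sumToℕ-cong (suc n) pair ⟩
      sumToℕ (suc n) (λ i → G (iter cycInv i p))              ≡⟨ sumToℕ≡sum (suc n) (λ i → G (iter cycInv i p)) ⟩
      sum {suc n} (λ k → G (iter cycInv (toℕ k) p))           ≡⟨ sum-reindex (λ k → iter cycInv (toℕ k) p)
                                                                              (iter-cycInv-injective p) G ⟩
      sum {suc n} G                                           ≡⟨ ∑-distrib-+ R R′ ⟩
      sum {suc n} R + sum {suc n} R′                          ≡⟨ cong (sum {suc n} R +_) (sum-reindex (lookup σ) σ-perm R′) ⟨
      sum {suc n} R + sum {suc n} (λ i → R′ (lookup σ i))     ≡⟨ ∑-distrib-+ R (λ i → R′ (lookup σ i)) ⟨
      sum {suc n} (λ i → R i + R′ (lookup σ i))               ≡⟨ sum-cong-≗ {suc n} pairs-to-n+2 ⟩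
      sum {suc n} (λ _ → suc (suc n))                         ≡⟨ sum-const {suc n} (suc (suc n)) ⟩
      suc n * suc (suc n)                                     ∎
      where
      open ≡-Reasoning
      g : Vec (Fin (suc n)) (suc n) → ℕ
      g τ = entry τ p
      R R′ G : Fin (suc n) → ℕ
      R j = suc (rotatedEntry σ j)
      R′ j = suc (rotatedEntry (kreweras σ) j)
      G j = R j + R′ j
      pair : ∀ i → windowSum kreweras g 2 (iter kreweras (i * 2) σ) ≡ G (iter cycInv i p)
      pair i = cong₂ _+_ (entry-iterate σ σ-perm i)
        (trans (cong g (sym (iter-comm kreweras (i * 2) σ))) (entry-iterate (kreweras σ) (kreweras-isPerm σ σ-perm) i))
      pairs-to-n+2 : ∀ i → R i + R′ (lookup σ i) ≡ suc (suc n)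
      pairs-to-n+2 i = trans (+-suc (R i) _) (cong (suc ∘ suc) (rotatedEntry-kreweras σ σ-perm i))

last-position-2p+2≡0 : ∀ n → (suc (toℕ (fromℕ n)) + suc (toℕ (fromℕ n))) % suc n ≡ 0
last-position-2p+2≡0 n = trans (cong (λ k → (suc k + suc k) % suc n) (toℕ-fromℕ n))
                               (trans ([m+n]%n≡m%n (suc n) (suc n)) (n%n≡0 (suc n)))

middle-position-2p+2≡0 : ∀ m → let p = fromℕ m ↑ˡ suc m in (suc (toℕ p) + suc (toℕ p)) % (suc m + suc m) ≡ 0
middle-position-2p+2≡0 m =
  trans (cong (λ k → (suc k + suc k) % (suc m + suc m)) (trans (toℕ-↑ˡ (fromℕ m) (suc m)) (toℕ-fromℕ m)))
        (n%n≡0 (suc m + suc m))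

theorem7p3 : (∀ (n : ℕ) →
    (Homomesic (IsPerm {suc n}) kreweras (λ σ → ℕ→ℚ (exc σ))
    × Homomesic (IsPerm {suc n}) krewerasInv (λ σ → ℕ→ℚ (exc σ)))
    × (Homomesic (IsPerm {suc n}) kreweras (λ σ → ℕ→ℚ (wdef σ))
    × Homomesic (IsPerm {suc n}) krewerasInv (λ σ → ℕ→ℚ (wdef σ)))
    × (Homomesic (IsPerm {suc n}) kreweras (λ σ → ℕ→ℚ (lastEntry σ))
    × Homomesic (IsPerm {suc n}) krewerasInv (λ σ → ℕ→ℚ (lastEntry σ))))
    × (∀ (m : ℕ) →
    Homomesic (IsPerm {suc m + suc m}) kreweras (λ σ → ℕ→ℚ (midEntry m σ))
    × Homomesic (IsPerm {suc m + suc m}) krewerasInv (λ σ → ℕ→ℚ (midEntry m σ)))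
theorem7p3 =
    (λ n → kreweras-homomesic exc 1 n exc+exc-kreweras
         , kreweras-homomesic wdef 1 (suc (suc n)) wdef+wdef-kreweras
         , kreweras-homomesic lastEntry (suc (n * 2)) (suc n * suc (suc n))
             (entry-windowSum (fromℕ n) (last-position-2p+2≡0 n)))
  , (λ m → kreweras-homomesic (midEntry m) (suc ((m + suc m) * 2)) ((suc m + suc m) * suc (suc m + suc m))
             (entry-windowSum (fromℕ m ↑ˡ suc m) (middle-position-2p+2≡0 m)))
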